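{- Let $G$ be a $4$-regular graph that is not $(3,1)$-colorable. If $G$ has a non-double, non-loop edge, then $G$ is not $2$-connected.
   Context: All graphs are finite, undirected pseudographs (multiple edges and loops allowed; a loop contributes $2$ to the degree). A $(3,1)$-coloring of a $4$-regular graph is an edge-coloring using at least two colors such that every vertex is incident to exactly $3$ edges of one color and exactly $1$ edge of a different color. A non-double edge $uv$ with $u\neq v$ is one that is the only edge joining $u$ and $v$. -}

module Defs where

open import Data.Nat using (ℕ; _≤_)
open import Data.Fin using (Fin)
import Data.Fin as F
open import Data.Nat as N using ()
open import Data.List using (List; map; allFin)
open import Data.Nat.ListAction using (sum)
open import Data.Product using (Σ; ∃; ∃-syntax; _×_; _,_; proj₁; proj₂)
open import Data.Sum using (_⊎_)
open import Data.Unit using (⊤)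
open import Data.Bool using (Bool; true; false; if_then_else_; _∧_)
open import Relation.Nullary using (¬_)
open import Relation.Nullary.Decidable using (⌊_⌋)
open import Relation.Binary.PropositionalEquality using (_≡_; _≢_)

-- A finite pseudograph: vertices Fin n, edges Fin m, each edge has two
-- endpoints (an unordered pair, stored in some order); ends e = (v , v) is a loop.
-- Parallel edges are distinct edge indices with the same endpoints.
record Graph : Set where
  field
    n    : ℕ
    m    : ℕ
    ends : Fin m → Fin n × Fin n

module _ (G : Graph) where
  open Graph G

  src tgt : Fin m → Fin n
  src e = proj₁ (ends e)
  tgt e = proj₂ (ends e)

  -- number of edge-ends (half-edges) at v of edges satisfying p
  -- (a loop at v contributes 2)
  halfEdgesAt : Fin n → (Fin m → Bool) → ℕ
  halfEdgesAt v p = sum (map (λ e →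
      (if ⌊ src e F.≟ v ⌋ ∧ p e then 1 else 0) N.+
      (if ⌊ tgt e F.≟ v ⌋ ∧ p e then 1 else 0)) (allFin m))

  degree : Fin n → ℕ
  degree v = halfEdgesAt v (λ _ → true)

  FourRegular : Set
  FourRegular = ∀ v → degree v ≡ 4

  colourDeg : (Fin m → ℕ) → Fin n → ℕ → ℕ
  colourDeg c v a = halfEdgesAt v (λ e → ⌊ c e N.≟ a ⌋)

  Is31Colouring : (Fin m → ℕ) → Set
  Is31Colouring c =
    (∃[ e ] ∃[ e' ] c e ≢ c e') ×
    (∀ v → ∃[ a ] ∃[ b ] (a ≢ b × colourDeg c v a ≡ 3 × colourDeg c v b ≡ 1))

  Colourable31 : Set
  Colourable31 = ∃[ c ] Is31Colouring c

  NonDoubleNonLoop : Fin m → Set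
  NonDoubleNonLoop e =
    src e ≢ tgt e ×
    (∀ e' → ((src e' ≡ src e × tgt e' ≡ tgt e) ⊎ (src e' ≡ tgt e × tgt e' ≡ src e)) → e' ≡ e)

  data Reach (S : Fin n → Set) : Fin n → Fin n → Set where
    here : ∀ {u} → S u → Reach S u u
    fwd  : ∀ {w} e → S (src e) → S (tgt e) → Reach S (tgt e) w → Reach S (src e) w
    bwd  : ∀ {w} e → S (src e) → S (tgt e) → Reach S (src e) w → Reach S (tgt e) w

  ConnectedOn : (Fin n → Set) → Set
  ConnectedOn S = ∀ u w → S u → S w → Reach S u w

  TwoConnected : Set
  TwoConnected =
    3 ≤ n × ConnectedOn (λ _ → ⊤) × (∀ v → ConnectedOn (λ x → x ≢ v))

-- If G has an even number of vertices, a parity join of the connected graph G that is odd at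
-- every vertex is a spanning subgraph F of odd degree everywhere; colouring F with 1 and the rest
-- with 0 is a (3,1)-colouring.  So the number of vertices is odd.  Let e = uv be the non-double
-- edge: colour e with 0, the three other edges at u with 1, and look for a parity join F in
-- G - u - v that makes colour 1 odd at every other vertex, colouring the remaining edges 2.  The
-- prescribed parities have even total (handshake lemma, odd order), so F exists unless some union
-- of components of G - u - v carries an odd total; then it and its complement are two nonempty
-- sides of {u, v}.  As G - v is connected, each side is entered by an edge from u, and u has only
-- three edges besides e, so some side X is entered by a single edge f = ux.  This edge is again
-- non-double, so the same argument yields a side T of {u, x} avoiding v.  If T leaves X, then u
-- separates T - X from v; otherwise x separates T from v.
module Submission where

open import Defs
open import Algebra.Bundles using (CommutativeMonoid; CommutativeRing)
import Algebra.Properties.CommutativeMonoid.Sum as CommutativeMonoidSum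
import Algebra.Properties.Semiring.Sum as SemiringSum
import Data.Bool as Bool
open import Data.Bool using (Bool; true; false; not; _∧_; _∨_; _xor_; if_then_else_)
open import Data.Bool.Properties
  using ( xor-∧-commutativeRing; ∧-identityʳ; ∧-zeroʳ; ∧-comm; ∧-distribˡ-xor; ∧-distribʳ-xor
        ; ∨-identityʳ; ∨-zeroʳ; ∨-inverseʳ; true-xor; xor-same; xor-identityʳ; xor-inverseʳ; xor-assoc
        ; not-distribˡ-xor; ¬-not; if-eta )
open import Data.Empty using (⊥; ⊥-elim)
open import Data.Fin using (Fin; zero; suc)
import Data.Fin as F
open import Data.Fin.Properties using (any?; punchInᵢ≢i)
open import Data.List using (List; []; _∷_; map; tabulate; allFin)
open import Data.List.Properties using (map-tabulate)
open import Data.List.Membership.Propositional using (_∈_)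
open import Data.List.Membership.Propositional.Properties using (∈-allFin)
open import Data.List.Relation.Unary.Any using (here; there)
open import Data.Nat using (ℕ; zero; suc; _+_; _≤_; z≤n; s≤s)
import Data.Nat as N
import Data.Nat.ListAction as ListAction
open import Data.Nat.Properties
  using ( +-*-semiring; +-0-commutativeMonoid; +-identityʳ; suc-injective
        ; m≤m+n; m≤n+m; ≤-trans; +-mono-≤; module ≤-Reasoning )
open import Data.Product using (Σ; ∃; ∃-syntax; _×_; _,_; proj₁; proj₂)
open import Data.Sum using (_⊎_; inj₁; inj₂)
open import Data.Unit using (⊤; tt)
open import Function using (_∘_)
open import Relation.Nullary using (¬_; Dec; yes; no; contradiction)
open import Relation.Nullary.Decidable using (⌊_⌋)
open import Relation.Binary.PropositionalEquality

module SumLemmas {c ℓ} (M : CommutativeMonoid c ℓ) where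
  open CommutativeMonoid M
    using (Carrier; _≈_; ∙-congˡ; identityʳ) renaming (ε to 0#; trans to ≈-trans)
  open CommutativeMonoidSum M using (sum; sum-cong-≋; sum-replicate-zero; sum-remove)

  sum-zero : ∀ {k} {f : Fin k → Carrier} → (∀ i → f i ≈ 0#) → sum f ≈ 0#
  sum-zero {k} h = ≈-trans (sum-cong-≋ h) (sum-replicate-zero k)

  sum-select : ∀ {k} (f : Fin k → Carrier) a → (∀ i → i ≢ a → f i ≈ 0#) → sum f ≈ f a
  sum-select {suc _} f a h = ≈-trans (sum-remove {i = a} f)
    (≈-trans (∙-congˡ (sum-zero (λ j → h _ (punchInᵢ≢i a j)))) (identityʳ (f a)))

module NatSum where
  open SemiringSum +-*-semiring public
  open SumLemmas +-0-commutativeMonoid public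

module XorSum where
  open SemiringSum (CommutativeRing.semiring xor-∧-commutativeRing) public
  open SumLemmas (CommutativeRing.+-commutativeMonoid xor-∧-commutativeRing) public

∑ : ∀ {k} → (Fin k → ℕ) → ℕ
∑ = NatSum.sum

⨁ : ∀ {k} → (Fin k → Bool) → Bool
⨁ = XorSum.sum

true≢false : true ≢ false
true≢false ()

∧-true : ∀ {a b} → a ∧ b ≡ true → a ≡ true × b ≡ true
∧-true {true} {true} _ = refl , refl

not-true : ∀ {a} → not a ≡ true → a ≡ false
not-true {false} _ = refl

∨-false : ∀ {a b} → a ∨ b ≡ false → a ≡ false × b ≡ false
∨-false {false} {false} _ = refl , refl

Bool-≡ : ∀ {a b} → (a ≡ true → b ≡ true) → (b ≡ true → a ≡ true) → a ≡ b
Bool-≡ {false} {false} _ _ = refl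
Bool-≡ {false} {true} _ b⇒a = b⇒a refl
Bool-≡ {true} {b} a⇒b _ = sym (a⇒b refl)

⌊⌋-true : ∀ {P : Set} (P? : Dec P) → P → ⌊ P? ⌋ ≡ true
⌊⌋-true (yes _) _ = refl
⌊⌋-true (no ¬p) p = ⊥-elim (¬p p)

⌊⌋-false : ∀ {P : Set} (P? : Dec P) → ¬ P → ⌊ P? ⌋ ≡ false
⌊⌋-false (yes p) ¬p = ⊥-elim (¬p p)
⌊⌋-false (no _) _ = refl

⌊⌋-sound : ∀ {P : Set} (P? : Dec P) → ⌊ P? ⌋ ≡ true → P
⌊⌋-sound (yes p) _ = p

_==_ : ∀ {k} → Fin k → Fin k → Bool
a == b = ⌊ a F.≟ b ⌋

==-refl : ∀ {k} (a : Fin k) → a == a ≡ true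
==-refl a = ⌊⌋-true (a F.≟ a) refl

==-false : ∀ {k} {a b : Fin k} → a ≢ b → a == b ≡ false
==-false = ⌊⌋-false (_ F.≟ _)

==-sound : ∀ {k} {a b : Fin k} → a == b ≡ true → a ≡ b
==-sound = ⌊⌋-sound (_ F.≟ _)

⨁-select : ∀ {k} (f : Fin k → Bool) a → ⨁ (λ i → (a == i) ∧ f i) ≡ f a
⨁-select f a = trans (XorSum.sum-select _ a (λ i i≢a → cong (_∧ f i) (==-false (i≢a ∘ sym))))
                     (cong (_∧ f a) (==-refl a))

isOdd : ℕ → Bool
isOdd zero = false
isOdd (suc k) = not (isOdd k)

isOdd-+ : ∀ a b → isOdd (a + b) ≡ isOdd a xor isOdd b
isOdd-+ zero b = refl
isOdd-+ (suc a) b = trans (cong not (isOdd-+ a b)) (not-distribˡ-xor (isOdd a) (isOdd b))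

isOdd-∑ : ∀ {k} (f : Fin k → ℕ) → isOdd (∑ f) ≡ ⨁ (isOdd ∘ f)
isOdd-∑ {zero} f = refl
isOdd-∑ {suc k} f = trans (isOdd-+ (f zero) _) (cong (isOdd (f zero) xor_) (isOdd-∑ (f ∘ suc)))

isOdd-if : ∀ b k → isOdd (if b then k else 0) ≡ b ∧ isOdd k
isOdd-if true k = refl
isOdd-if false k = refl

⨁-true : ∀ k → ⨁ {k} (λ _ → true) ≡ isOdd k
⨁-true zero = refl
⨁-true (suc k) = cong not (⨁-true k)

⨁-not : ∀ {k} (f : Fin k → Bool) → ⨁ (not ∘ f) ≡ isOdd k xor ⨁ f
⨁-not {k} f = begin
  ⨁ (not ∘ f)                   ≡⟨ XorSum.sum-cong-≗ (λ i → sym (true-xor (f i))) ⟩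
  ⨁ (λ i → true xor f i)        ≡⟨ XorSum.∑-distrib-+ (λ _ → true) f ⟩
  ⨁ {k} (λ _ → true) xor ⨁ f    ≡⟨ cong (_xor ⨁ f) (⨁-true k) ⟩
  isOdd k xor ⨁ f               ∎
  where open ≡-Reasoning

⨁-witness : ∀ {k} (f : Fin k → Bool) → ⨁ f ≡ true → ∃[ i ] f i ≡ true
⨁-witness f h with any? (λ i → f i Bool.≟ true)
... | yes w = w
... | no ¬w = ⊥-elim (true≢false (trans (sym h) (XorSum.sum-zero (λ i → ¬-not (λ fi → ¬w (i , fi))))))

⨁-without : ∀ {k} {u v : Fin k} → u ≢ v → (f : Fin k → Bool) →
            ⨁ (λ w → (not (u == w) ∧ not (v == w)) ∧ f w) ≡ (⨁ f xor f u) xor f v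
⨁-without {u = u} {v} u≢v f = begin
  ⨁ (λ w → (not (u == w) ∧ not (v == w)) ∧ f w)
    ≡⟨ XorSum.sum-cong-≗ (λ w → pointwise (u == w) (v == w) (f w) (apart w)) ⟩
  ⨁ (λ w → (f w xor ((u == w) ∧ f w)) xor ((v == w) ∧ f w))
    ≡⟨ XorSum.∑-distrib-+ (λ w → f w xor ((u == w) ∧ f w)) (λ w → (v == w) ∧ f w) ⟩
  ⨁ (λ w → f w xor ((u == w) ∧ f w)) xor ⨁ (λ w → (v == w) ∧ f w)
    ≡⟨ cong (_xor ⨁ (λ w → (v == w) ∧ f w)) (XorSum.∑-distrib-+ f (λ w → (u == w) ∧ f w)) ⟩
  (⨁ f xor ⨁ (λ w → (u == w) ∧ f w)) xor ⨁ (λ w → (v == w) ∧ f w)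
    ≡⟨ cong₂ (λ x y → (⨁ f xor x) xor y) (⨁-select f u) (⨁-select f v) ⟩
  (⨁ f xor f u) xor f v ∎
  where
  open ≡-Reasoning
  apart : ∀ w → (u == w) ∧ (v == w) ≡ false
  apart w with u == w in uw
  ... | false = refl
  ... | true rewrite sym (==-sound uw) = ==-false (u≢v ∘ sym)
  pointwise : ∀ a b x → a ∧ b ≡ false → (not a ∧ not b) ∧ x ≡ (x xor (a ∧ x)) xor (b ∧ x)
  pointwise false false x _ = sym (trans (xor-identityʳ (x xor false)) (xor-identityʳ x))
  pointwise false true x _ = sym (trans (cong (_xor x) (xor-identityʳ x)) (xor-same x))
  pointwise true false x _ = sym (trans (xor-identityʳ (x xor x)) (xor-same x))

sum-tabulate : ∀ {k} (f : Fin k → ℕ) → ListAction.sum (tabulate f) ≡ ∑ f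
sum-tabulate {zero} f = refl
sum-tabulate {suc k} f = cong (f zero +_) (sum-tabulate (f ∘ suc))

if-∨-disjoint : ∀ q r k → q ∧ r ≡ false →
  (if q ∨ r then k else 0) ≡ (if q then k else 0) + (if r then k else 0)
if-∨-disjoint true false k _ = sym (+-identityʳ k)
if-∨-disjoint false r k _ = refl

module Degrees (G : Graph) where
  open Graph G

  incident : Fin n → Fin m → Bool
  incident v e = src G e == v ∨ tgt G e == v

  oddAt : Fin n → Fin m → Bool
  oddAt v e = src G e == v xor tgt G e == v

  endsAt : Fin n → Fin m → ℕ
  endsAt v e = (if src G e == v then 1 else 0) + (if tgt G e == v then 1 else 0)

  deg : Fin n → (Fin m → Bool) → ℕ
  deg = halfEdgesAt G

  endsAt-nonincident : ∀ v e → incident v e ≡ false → endsAt v e ≡ 0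
  endsAt-nonincident v e h with src G e == v | tgt G e == v
  endsAt-nonincident v e refl | false | false = refl

  endsAt-incident : ∀ v e → incident v e ≡ true → 1 ≤ endsAt v e
  endsAt-incident v e h with src G e == v | tgt G e == v
  ... | true | _ = s≤s z≤n
  ... | false | true = s≤s z≤n

  isOdd-endsAt : ∀ v e → isOdd (endsAt v e) ≡ oddAt v e
  isOdd-endsAt v e = trans (isOdd-+ (if src G e == v then 1 else 0) _)
    (cong₂ _xor_ (trans (isOdd-if (src G e == v) 1) (∧-identityʳ _))
                 (trans (isOdd-if (tgt G e == v) 1) (∧-identityʳ _)))

  private
    restrict : ∀ a b q → (if a ∧ q then 1 else 0) + (if b ∧ q then 1 else 0)
                         ≡ (if q then (if a then 1 else 0) + (if b then 1 else 0) else 0)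
    restrict a b true rewrite ∧-identityʳ a | ∧-identityʳ b = refl
    restrict a b false rewrite ∧-zeroʳ a | ∧-zeroʳ b = refl

  deg≡∑ : ∀ v p → deg v p ≡ ∑ (λ e → if p e then endsAt v e else 0)
  deg≡∑ v p = begin
    ListAction.sum (map h (allFin m))
      ≡⟨ cong ListAction.sum (map-tabulate (λ e → e) h) ⟩
    ListAction.sum (tabulate h)
      ≡⟨ sum-tabulate h ⟩
    ∑ h
      ≡⟨ NatSum.sum-cong-≗ (λ e → restrict (src G e == v) (tgt G e == v) (p e)) ⟩
    ∑ (λ e → if p e then endsAt v e else 0) ∎
    where
    open ≡-Reasoning
    h : Fin m → ℕ
    h e = (if src G e == v ∧ p e then 1 else 0) + (if tgt G e == v ∧ p e then 1 else 0)

  deg-congᵢ : ∀ v {p q} → (∀ e → incident v e ≡ true → p e ≡ q e) → deg v p ≡ deg v q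
  deg-congᵢ v {p} {q} h = begin
    deg v p                                  ≡⟨ deg≡∑ v p ⟩
    ∑ (λ e → if p e then endsAt v e else 0)  ≡⟨ NatSum.sum-cong-≗ pointwise ⟩
    ∑ (λ e → if q e then endsAt v e else 0)  ≡⟨ deg≡∑ v q ⟨
    deg v q                                  ∎
    where
    open ≡-Reasoning
    pointwise : ∀ e → (if p e then endsAt v e else 0) ≡ (if q e then endsAt v e else 0)
    pointwise e with incident v e in i
    ... | true = cong (λ b → if b then endsAt v e else 0) (h e i)
    ... | false rewrite endsAt-nonincident v e i = trans (if-eta (p e)) (sym (if-eta (q e)))

  deg-empty : ∀ v → deg v (λ _ → false) ≡ 0
  deg-empty v = trans (deg≡∑ v _) (NatSum.sum-zero {m} (λ _ → refl))

  deg-split : ∀ v {p} q r → (∀ e → incident v e ≡ true → p e ≡ q e ∨ r e) →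
              (∀ e → q e ∧ r e ≡ false) → deg v p ≡ deg v q + deg v r
  deg-split v {p} q r cover disjoint = begin
    deg v p
      ≡⟨ deg-congᵢ v cover ⟩
    deg v (λ e → q e ∨ r e)
      ≡⟨ deg≡∑ v _ ⟩
    ∑ (λ e → if q e ∨ r e then endsAt v e else 0)
      ≡⟨ NatSum.sum-cong-≗ (λ e → if-∨-disjoint (q e) (r e) _ (disjoint e)) ⟩
    ∑ (λ e → (if q e then endsAt v e else 0) + (if r e then endsAt v e else 0))
      ≡⟨ NatSum.∑-distrib-+ (λ e → if q e then endsAt v e else 0) (λ e → if r e then endsAt v e else 0) ⟩
    ∑ (λ e → if q e then endsAt v e else 0) + ∑ (λ e → if r e then endsAt v e else 0)
      ≡⟨ cong₂ _+_ (deg≡∑ v q) (deg≡∑ v r) ⟨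
    deg v q + deg v r ∎
    where open ≡-Reasoning

  deg-mono : ∀ v {p q} → (∀ e → p e ≡ true → q e ≡ true) → deg v p ≤ deg v q
  deg-mono v {p} {q} p⊆q =
    subst (deg v p ≤_) (sym (deg-split v p (λ e → q e ∧ not (p e)) (λ e _ → cover e) disjoint)) (m≤m+n _ _)
    where
    cover : ∀ e → q e ≡ p e ∨ (q e ∧ not (p e))
    cover e with p e in pe
    ... | true = p⊆q e pe
    ... | false = sym (∧-identityʳ (q e))
    disjoint : ∀ e → p e ∧ (q e ∧ not (p e)) ≡ false
    disjoint e with p e
    ... | true = ∧-zeroʳ (q e)
    ... | false = refl

  deg-disjoint-≤ : ∀ v {p} q r → (∀ e → q e ∧ r e ≡ false) →
                   (∀ e → q e ≡ true → p e ≡ true) → (∀ e → r e ≡ true → p e ≡ true) →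
                   deg v q + deg v r ≤ deg v p
  deg-disjoint-≤ v {p} q r disjoint q⊆p r⊆p =
    subst (_≤ deg v p) (deg-split v q r (λ _ _ → refl) disjoint) (deg-mono v q∨r⊆p)
    where
    q∨r⊆p : ∀ e → q e ∨ r e ≡ true → p e ≡ true
    q∨r⊆p e h with q e in qe
    ... | true = q⊆p e qe
    ... | false = r⊆p e h

  deg-single : ∀ v e → deg v (e ==_) ≡ endsAt v e
  deg-single v e = begin
    deg v (e ==_)
      ≡⟨ deg≡∑ v (e ==_) ⟩
    ∑ (λ g → if e == g then endsAt v g else 0)
      ≡⟨ NatSum.sum-select _ e (λ g g≢e → cong (λ b → if b then endsAt v g else 0) (==-false (g≢e ∘ sym))) ⟩
    (if e == e then endsAt v e else 0)
      ≡⟨ cong (λ b → if b then endsAt v e else 0) (==-refl e) ⟩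
    endsAt v e ∎
    where open ≡-Reasoning

  deg-witness : ∀ v p → 1 ≤ deg v p → ∃[ e ] p e ≡ true
  deg-witness v p h with any? (λ e → p e Bool.≟ true)
  ... | yes w = w
  ... | no ¬w = contradiction (subst (1 ≤_) deg≡0 h) λ ()
    where
    deg≡0 : deg v p ≡ 0
    deg≡0 = trans (deg-congᵢ v (λ e _ → ¬-not (λ pe → ¬w (e , pe)))) (deg-empty v)

  deg≤1⇒unique : ∀ v {p f g} → deg v p ≤ 1 → p f ≡ true → p g ≡ true →
                 incident v f ≡ true → incident v g ≡ true → f ≡ g
  deg≤1⇒unique v {p} {f} {g} h pf pg vf vg with f F.≟ g
  ... | yes f≡g = f≡g
  ... | no f≢g = contradiction (≤-trans two h) λ { (s≤s ()) }
    where
    disjoint : ∀ e → (f == e) ∧ (g == e) ≡ false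
    disjoint e with f == e in fe
    ... | false = refl
    ... | true rewrite sym (==-sound fe) = ==-false (f≢g ∘ sym)
    within : ∀ e → (f == e) ∨ (g == e) ≡ true → p e ≡ true
    within e h with f == e in fe | g == e in ge
    ... | true | _ = subst (λ x → p x ≡ true) (==-sound fe) pf
    ... | false | true = subst (λ x → p x ≡ true) (==-sound ge) pg
    two : 2 ≤ deg v p
    two = begin
      2
        ≤⟨ +-mono-≤ (endsAt-incident v f vf) (endsAt-incident v g vg) ⟩
      endsAt v f + endsAt v g
        ≡⟨ cong₂ _+_ (deg-single v f) (deg-single v g) ⟨
      deg v (f ==_) + deg v (g ==_)
        ≡⟨ deg-split v (f ==_) (g ==_) (λ _ _ → refl) disjoint ⟨
      deg v (λ e → (f == e) ∨ (g == e))
        ≤⟨ deg-mono v within ⟩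
      deg v p ∎
      where open ≤-Reasoning

  isOdd-deg : ∀ v p → isOdd (deg v p) ≡ ⨁ (λ e → oddAt v e ∧ p e)
  isOdd-deg v p = begin
    isOdd (deg v p)
      ≡⟨ cong isOdd (deg≡∑ v p) ⟩
    isOdd (∑ (λ e → if p e then endsAt v e else 0))
      ≡⟨ isOdd-∑ (λ e → if p e then endsAt v e else 0) ⟩
    ⨁ (λ e → isOdd (if p e then endsAt v e else 0))
      ≡⟨ XorSum.sum-cong-≗ pointwise ⟩
    ⨁ (λ e → oddAt v e ∧ p e) ∎
    where
    open ≡-Reasoning
    pointwise : ∀ e → isOdd (if p e then endsAt v e else 0) ≡ oddAt v e ∧ p e
    pointwise e = trans (isOdd-if (p e) _) (trans (cong (p e ∧_) (isOdd-endsAt v e)) (∧-comm (p e) (oddAt v e)))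

  isOdd-deg-xor : ∀ v p q → isOdd (deg v (λ e → p e xor q e)) ≡ isOdd (deg v p) xor isOdd (deg v q)
  isOdd-deg-xor v p q = begin
    isOdd (deg v (λ e → p e xor q e))
      ≡⟨ isOdd-deg v _ ⟩
    ⨁ (λ e → oddAt v e ∧ (p e xor q e))
      ≡⟨ XorSum.sum-cong-≗ (λ e → ∧-distribˡ-xor (oddAt v e) (p e) (q e)) ⟩
    ⨁ (λ e → (oddAt v e ∧ p e) xor (oddAt v e ∧ q e))
      ≡⟨ XorSum.∑-distrib-+ (λ e → oddAt v e ∧ p e) (λ e → oddAt v e ∧ q e) ⟩
    ⨁ (λ e → oddAt v e ∧ p e) xor ⨁ (λ e → oddAt v e ∧ q e)
      ≡⟨ cong₂ _xor_ (isOdd-deg v p) (isOdd-deg v q) ⟨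
    isOdd (deg v p) xor isOdd (deg v q) ∎
    where open ≡-Reasoning

  ⨁-oddAt : ∀ e (S : Fin n → Bool) → ⨁ (λ w → oddAt w e ∧ S w) ≡ S (src G e) xor S (tgt G e)
  ⨁-oddAt e S = begin
    ⨁ (λ w → oddAt w e ∧ S w)
      ≡⟨ XorSum.sum-cong-≗ (λ w → ∧-distribʳ-xor (S w) (src G e == w) (tgt G e == w)) ⟩
    ⨁ (λ w → ((src G e == w) ∧ S w) xor ((tgt G e == w) ∧ S w))
      ≡⟨ XorSum.∑-distrib-+ (λ w → (src G e == w) ∧ S w) (λ w → (tgt G e == w) ∧ S w) ⟩
    ⨁ (λ w → (src G e == w) ∧ S w) xor ⨁ (λ w → (tgt G e == w) ∧ S w)
      ≡⟨ cong₂ _xor_ (⨁-select S (src G e)) (⨁-select S (tgt G e)) ⟩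
    S (src G e) xor S (tgt G e) ∎
    where open ≡-Reasoning

  handshake : ∀ p → ⨁ (λ v → isOdd (deg v p)) ≡ false
  handshake p = begin
    ⨁ (λ v → isOdd (deg v p))
      ≡⟨ XorSum.sum-cong-≗ (λ v → isOdd-deg v p) ⟩
    ⨁ (λ v → ⨁ (λ e → oddAt v e ∧ p e))
      ≡⟨ XorSum.∑-comm (λ v e → oddAt v e ∧ p e) ⟩
    ⨁ (λ e → ⨁ (λ v → oddAt v e ∧ p e))
      ≡⟨ XorSum.sum-cong-≗ (λ e → trans (⨁-oddAt e (λ _ → p e)) (xor-same (p e))) ⟩
    ⨁ {m} (λ _ → false)
      ≡⟨ XorSum.sum-zero {m} (λ _ → refl) ⟩
    false ∎
    where open ≡-Reasoning

  Joins : Fin m → Fin n → Fin n → Set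
  Joins g a b = (src G g ≡ a × tgt G g ≡ b) ⊎ (src G g ≡ b × tgt G g ≡ a)

  incident-src : ∀ g → incident (src G g) g ≡ true
  incident-src g rewrite ==-refl (src G g) = refl

  incident-tgt : ∀ g → incident (tgt G g) g ≡ true
  incident-tgt g rewrite ==-refl (tgt G g) = ∨-zeroʳ _

  incident-ends : ∀ {a g} → incident a g ≡ true → src G g ≡ a ⊎ tgt G g ≡ a
  incident-ends {a} {g} h with src G g == a in sa | tgt G g == a in ta
  ... | true | _ = inj₁ (==-sound sa)
  ... | false | true = inj₂ (==-sound ta)

  nonincident : ∀ {a g} → src G g ≢ a → tgt G g ≢ a → incident a g ≡ false
  nonincident sa ta rewrite ==-false sa | ==-false ta = refl

  nonincident⁻¹ : ∀ {a g} → incident a g ≡ false → src G g ≢ a × tgt G g ≢ a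
  nonincident⁻¹ {a} {g} h = (λ sa → true≢false (trans (sym (incident-at-src sa)) h)) ,
                            (λ ta → true≢false (trans (sym (incident-at-tgt ta)) h))
    where
    incident-at-src : src G g ≡ a → incident a g ≡ true
    incident-at-src refl = incident-src g
    incident-at-tgt : tgt G g ≡ a → incident a g ≡ true
    incident-at-tgt refl = incident-tgt g

  joins-incident : ∀ {g a b} → Joins g a b → incident a g ≡ true × incident b g ≡ true
  joins-incident {g} (inj₁ (refl , refl)) = incident-src g , incident-tgt g
  joins-incident {g} (inj₂ (refl , refl)) = incident-tgt g , incident-src g

  incident-joins : ∀ {g a b} → a ≢ b → incident a g ≡ true → incident b g ≡ true → Joins g a b
  incident-joins a≢b ag bg with incident-ends ag | incident-ends bg
  ... | inj₁ sa | inj₁ sb = ⊥-elim (a≢b (trans (sym sa) sb))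
  ... | inj₁ sa | inj₂ tb = inj₁ (sa , tb)
  ... | inj₂ ta | inj₁ sb = inj₂ (sb , ta)
  ... | inj₂ ta | inj₂ tb = ⊥-elim (a≢b (trans (sym ta) tb))

  endsAt-joins : ∀ {g a b} → a ≢ b → Joins g a b → endsAt a g ≡ 1
  endsAt-joins {a = a} a≢b (inj₁ (refl , refl)) rewrite ==-refl a | ==-false (a≢b ∘ sym) = refl
  endsAt-joins {a = a} a≢b (inj₂ (refl , refl)) rewrite ==-refl a | ==-false (a≢b ∘ sym) = refl

  joins-ends : ∀ {g a b y} → Joins g a b → incident y g ≡ true → y ≡ a ⊎ y ≡ b
  joins-ends (inj₁ (sa , tb)) yg with incident-ends yg
  ... | inj₁ sy = inj₁ (trans (sym sy) sa)
  ... | inj₂ ty = inj₂ (trans (sym ty) tb)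
  joins-ends (inj₂ (sb , ta)) yg with incident-ends yg
  ... | inj₁ sy = inj₂ (trans (sym sy) sb)
  ... | inj₂ ty = inj₁ (trans (sym ty) ta)

  joins-sym : ∀ {g a b} → Joins g a b → Joins g b a
  joins-sym (inj₁ ends) = inj₂ ends
  joins-sym (inj₂ ends) = inj₁ ends

  connected-constant : ∀ {P} → ConnectedOn G P → (Y : Fin n → Bool) →
    (∀ e → P (src G e) → P (tgt G e) → Y (src G e) ≡ Y (tgt G e)) →
    ∀ {a b} → P a → P b → Y a ≡ Y b
  connected-constant {P} conn Y closed {a} {b} Pa Pb = along (conn a b Pa Pb)
    where
    along : ∀ {a b} → Reach G P a b → Y a ≡ Y b
    along (here _) = refl
    along (fwd e Ps Pt r) = trans (closed e Ps Pt) (along r)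
    along (bwd e Ps Pt r) = trans (sym (closed e Ps Pt)) (along r)

module ParityJoins (G : Graph) (A : Fin (Graph.m G) → Bool) where
  open Graph G
  open Degrees G

  ParityJoin : (Fin n → Bool) → Set
  ParityJoin τ = Σ (Fin m → Bool) λ F →
    (∀ e → F e ≡ true → A e ≡ true) × (∀ w → isOdd (deg w F) ≡ τ w)

  ClosedAlong : List (Fin m) → (Fin n → Bool) → Set
  ClosedAlong L S = ∀ e → e ∈ L → A e ≡ true → S (src G e) ≡ S (tgt G e)

  Obstruction : List (Fin m) → (Fin n → Bool) → Set
  Obstruction L τ = Σ (Fin n → Bool) λ S → ClosedAlong L S × ⨁ (λ w → S w ∧ τ w) ≡ true

  toggle : Fin m → (Fin n → Bool) → Fin n → Bool
  toggle e τ w = τ w xor oddAt w e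

  closedAlong-∷ : ∀ {L S} e → ClosedAlong L S → (A e ≡ true → S (src G e) ≡ S (tgt G e)) →
                  ClosedAlong (e ∷ L) S
  closedAlong-∷ e closed closed-e .e (here refl) = closed-e
  closedAlong-∷ e closed closed-e g (there g∈L) = closed g g∈L

  ⨁-toggle : ∀ e τ (S : Fin n → Bool) →
             ⨁ (λ w → S w ∧ toggle e τ w) ≡ ⨁ (λ w → S w ∧ τ w) xor (S (src G e) xor S (tgt G e))
  ⨁-toggle e τ S = begin
    ⨁ (λ w → S w ∧ toggle e τ w)
      ≡⟨ XorSum.sum-cong-≗ (λ w → ∧-distribˡ-xor (S w) (τ w) (oddAt w e)) ⟩
    ⨁ (λ w → (S w ∧ τ w) xor (S w ∧ oddAt w e))
      ≡⟨ XorSum.∑-distrib-+ (λ w → S w ∧ τ w) (λ w → S w ∧ oddAt w e) ⟩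
    ⨁ (λ w → S w ∧ τ w) xor ⨁ (λ w → S w ∧ oddAt w e)
      ≡⟨ cong (⨁ (λ w → S w ∧ τ w) xor_) (trans (XorSum.sum-cong-≗ (λ w → ∧-comm (S w) (oddAt w e))) (⨁-oddAt e S)) ⟩
    ⨁ (λ w → S w ∧ τ w) xor (S (src G e) xor S (tgt G e)) ∎
    where open ≡-Reasoning

  join-toggle : ∀ {e τ} → A e ≡ true → ParityJoin (toggle e τ) → ParityJoin τ
  join-toggle {e} {τ} Ae (F , F⊆A , parity) = (λ g → F g xor (e == g)) , F′⊆A , parity′
    where
    F′⊆A : ∀ g → F g xor (e == g) ≡ true → A g ≡ true
    F′⊆A g h with e == g in eg
    ... | true = subst (λ x → A x ≡ true) (==-sound eg) Ae
    ... | false = F⊆A g (trans (sym (xor-identityʳ (F g))) h)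
    parity′ : ∀ w → isOdd (deg w (λ g → F g xor (e == g))) ≡ τ w
    parity′ w = begin
      isOdd (deg w (λ g → F g xor (e == g)))
        ≡⟨ isOdd-deg-xor w F (e ==_) ⟩
      isOdd (deg w F) xor isOdd (deg w (e ==_))
        ≡⟨ cong₂ _xor_ (parity w) (trans (cong isOdd (deg-single w e)) (isOdd-endsAt w e)) ⟩
      (τ w xor oddAt w e) xor oddAt w e
        ≡⟨ xor-assoc (τ w) (oddAt w e) (oddAt w e) ⟩
      τ w xor (oddAt w e xor oddAt w e)
        ≡⟨ cong (τ w xor_) (xor-same (oddAt w e)) ⟩
      τ w xor false
        ≡⟨ xor-identityʳ (τ w) ⟩
      τ w ∎
      where open ≡-Reasoning

  private
    xor-≢ : ∀ {a b c d : Bool} → a ≢ b → c ≢ d → a xor c ≡ b xor d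
    xor-≢ {false} {false} a≢b _ = ⊥-elim (a≢b refl)
    xor-≢ {true} {true} a≢b _ = ⊥-elim (a≢b refl)
    xor-≢ {c = false} {false} _ c≢d = ⊥-elim (c≢d refl)
    xor-≢ {c = true} {true} _ c≢d = ⊥-elim (c≢d refl)
    xor-≢ {false} {true} {false} {true} _ _ = refl
    xor-≢ {false} {true} {true} {false} _ _ = refl
    xor-≢ {true} {false} {false} {true} _ _ = refl
    xor-≢ {true} {false} {true} {false} _ _ = refl

    flip-true : ∀ a → a xor true ≡ true → a ≡ false
    flip-true false _ = refl
    flip-true true ()

    ≢⇒xor : ∀ {a b : Bool} → a ≢ b → a xor b ≡ true
    ≢⇒xor {false} {false} a≢b = ⊥-elim (a≢b refl)
    ≢⇒xor {false} {true} _ = refl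
    ≢⇒xor {true} {false} _ = refl
    ≢⇒xor {true} {true} a≢b = ⊥-elim (a≢b refl)

  untoggle-odd : ∀ e τ (S : Fin n → Bool) → S (src G e) ≡ S (tgt G e) →
                 ⨁ (λ w → S w ∧ toggle e τ w) ≡ true → ⨁ (λ w → S w ∧ τ w) ≡ true
  untoggle-odd e τ S same odd = begin
    ⨁ (λ w → S w ∧ τ w)
      ≡⟨ xor-identityʳ (⨁ (λ w → S w ∧ τ w)) ⟨
    ⨁ (λ w → S w ∧ τ w) xor false
      ≡⟨ cong (⨁ (λ w → S w ∧ τ w) xor_) (trans (cong (_xor S (tgt G e)) same) (xor-same (S (tgt G e)))) ⟨
    ⨁ (λ w → S w ∧ τ w) xor (S (src G e) xor S (tgt G e))
      ≡⟨ ⨁-toggle e τ S ⟨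
    ⨁ (λ w → S w ∧ toggle e τ w)
      ≡⟨ odd ⟩
    true ∎
    where open ≡-Reasoning

  combine-odd : ∀ e τ (S S′ : Fin n → Bool) → S′ (src G e) ≢ S′ (tgt G e) → ⨁ (λ w → S w ∧ τ w) ≡ true →
                ⨁ (λ w → S′ w ∧ toggle e τ w) ≡ true → ⨁ (λ w → (S w xor S′ w) ∧ τ w) ≡ true
  combine-odd e τ S S′ differ odd odd′ = begin
    ⨁ (λ w → (S w xor S′ w) ∧ τ w)
      ≡⟨ XorSum.sum-cong-≗ (λ w → ∧-distribʳ-xor (τ w) (S w) (S′ w)) ⟩
    ⨁ (λ w → (S w ∧ τ w) xor (S′ w ∧ τ w))
      ≡⟨ XorSum.∑-distrib-+ (λ w → S w ∧ τ w) (λ w → S′ w ∧ τ w) ⟩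
    ⨁ (λ w → S w ∧ τ w) xor ⨁ (λ w → S′ w ∧ τ w)
      ≡⟨ cong₂ _xor_ odd even′ ⟩
    true ∎
    where
    open ≡-Reasoning
    even′ : ⨁ (λ w → S′ w ∧ τ w) ≡ false
    even′ = flip-true _ (trans (cong (⨁ (λ w → S′ w ∧ τ w) xor_) (sym (≢⇒xor differ)))
                                (trans (sym (⨁-toggle e τ S′)) odd′))

  -- If e separates the obstruction S, retry with the parities at the ends of e toggled: a join
  -- of the toggled problem extends by e, and an obstruction to it is either one for τ as well or
  -- combines with S into one.
  joinOrObstruction : ∀ L τ → ParityJoin τ ⊎ Obstruction L τ
  joinOrObstruction [] τ with any? (λ w → τ w Bool.≟ true)
  ... | yes (w , τw) = inj₂ ((w ==_) , (λ _ ()) , trans (⨁-select τ w) τw)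
  ... | no ¬τ = inj₁ ((λ _ → false) , (λ _ ()) ,
                      λ w → trans (cong isOdd (deg-empty w)) (sym (¬-not (λ τw → ¬τ (w , τw)))))
  joinOrObstruction (e ∷ L) τ with joinOrObstruction L τ
  ... | inj₁ J = inj₁ J
  ... | inj₂ (S , closed , odd) with S (src G e) Bool.≟ S (tgt G e) | A e in Ae
  ...   | yes same | _ = inj₂ (S , closedAlong-∷ {L} {S} e closed (λ _ → same) , odd)
  ...   | no _ | false =
          inj₂ (S , closedAlong-∷ {L} {S} e closed (λ Ae′ → ⊥-elim (true≢false (trans (sym Ae′) Ae))) , odd)
  ...   | no differ | true with joinOrObstruction L (toggle e τ)
  ...     | inj₁ J = inj₁ (join-toggle Ae J)
  ...     | inj₂ (S′ , closed′ , odd′) with S′ (src G e) Bool.≟ S′ (tgt G e)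
  ...       | yes same′ = inj₂ (S′ , closedAlong-∷ {L} {S′} e closed′ (λ _ → same′) , untoggle-odd e τ S′ same′ odd′)
  ...       | no differ′ = inj₂ ((λ w → S w xor S′ w) , closedAlong-∷ {L} {λ w → S w xor S′ w} e
                 (λ g g∈L Ag → cong₂ _xor_ (closed g g∈L Ag) (closed′ g g∈L Ag)) (λ _ → xor-≢ differ differ′) ,
                 combine-odd e τ S S′ differ′ odd odd′)

  parityJoin⊎obstruction : ∀ τ → ParityJoin τ ⊎
    Σ (Fin n → Bool) λ S → (∀ e → A e ≡ true → S (src G e) ≡ S (tgt G e)) × ⨁ (λ w → S w ∧ τ w) ≡ true
  parityJoin⊎obstruction τ with joinOrObstruction (allFin m) τ
  ... | inj₁ J = inj₁ J
  ... | inj₂ (S , closed , odd) = inj₂ (S , (λ e → closed e (∈-allFin e)) , odd)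

odd-split-4 : ∀ x y → x + y ≡ 4 → isOdd x ≡ true → (x ≡ 3 × y ≡ 1) ⊎ (x ≡ 1 × y ≡ 3)
odd-split-4 1 .3 refl _ = inj₂ (refl , refl)
odd-split-4 3 .1 refl _ = inj₁ (refl , refl)
odd-split-4 0 _ _ ()
odd-split-4 2 _ _ ()
odd-split-4 4 _ _ ()
odd-split-4 (suc (suc (suc (suc (suc x))))) y () _

module Colourings (G : Graph) where
  open Graph G
  open Degrees G

  Local31 : (Fin m → ℕ) → Fin n → Set
  Local31 c v = ∃[ a ] ∃[ b ] (a ≢ b × colourDeg G c v a ≡ 3 × colourDeg G c v b ≡ 1)

  local31 : ∀ {c v a b} → degree G v ≡ 4 → a ≢ b → (∀ g → incident v g ≡ true → c g ≡ a ⊎ c g ≡ b) →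
            isOdd (colourDeg G c v a) ≡ true → Local31 c v
  local31 {c} {v} {a} {b} deg4 a≢b twoColours odd with odd-split-4 _ _ sum4 odd
    where
    cover : ∀ g → incident v g ≡ true → true ≡ ⌊ c g N.≟ a ⌋ ∨ ⌊ c g N.≟ b ⌋
    cover g vg with twoColours g vg
    ... | inj₁ ca rewrite ⌊⌋-true (c g N.≟ a) ca = refl
    ... | inj₂ cb rewrite ⌊⌋-true (c g N.≟ b) cb = sym (∨-zeroʳ _)
    disjoint : ∀ g → ⌊ c g N.≟ a ⌋ ∧ ⌊ c g N.≟ b ⌋ ≡ false
    disjoint g with c g N.≟ a
    ... | yes ca = ⌊⌋-false (c g N.≟ b) (λ cb → a≢b (trans (sym ca) cb))
    ... | no _ = refl
    sum4 : colourDeg G c v a + colourDeg G c v b ≡ 4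
    sum4 = trans (sym (deg-split v _ _ cover disjoint)) deg4
  ... | inj₁ (three , one) = a , b , a≢b , three , one
  ... | inj₂ (one , three) = b , a , a≢b ∘ sym , three , one

  colourable31 : ∀ {c} → Fin n → (∀ v → Local31 c v) → Colourable31 G
  colourable31 {c} v₀ local with local v₀
  ... | a , b , a≢b , three , one
      with deg-witness v₀ _ (subst (1 ≤_) (sym three) (s≤s z≤n))
         | deg-witness v₀ _ (subst (1 ≤_) (sym one) (s≤s z≤n))
  ... | g , ga | g′ , g′b = c , (g , g′ , cg≢cg′) , local
    where
    cg≢cg′ : c g ≢ c g′
    cg≢cg′ eq = a≢b (trans (sym (⌊⌋-sound (c g N.≟ a) ga)) (trans eq (⌊⌋-sound (c g′ N.≟ b) g′b)))

  evenOrder-colourable : FourRegular G → ConnectedOn G (λ _ → ⊤) → isOdd n ≡ false → Fin n → Colourable31 G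
  evenOrder-colourable reg conn even v₀ with ParityJoins.parityJoin⊎obstruction G (λ _ → true) (λ _ → true)
  ... | inj₁ (F , _ , oddF) = colourable31 {c} v₀ λ v →
        local31 (reg v) (λ ()) (λ g _ → oneOrZero (F g))
                (trans (cong isOdd (deg-congᵢ v (λ g _ → isOne (F g)))) (oddF v))
    where
    c : Fin m → ℕ
    c g = if F g then 1 else 0
    oneOrZero : ∀ b → (if b then 1 else 0) ≡ 1 ⊎ (if b then 1 else 0) ≡ 0
    oneOrZero true = inj₁ refl
    oneOrZero false = inj₂ refl
    isOne : ∀ b → ⌊ (if b then 1 else 0) N.≟ 1 ⌋ ≡ b
    isOne true = refl
    isOne false = refl
  ... | inj₂ (S , closed , odd) = ⊥-elim (true≢false (begin
        true
          ≡⟨ odd ⟨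
        ⨁ (λ w → S w ∧ true)
          ≡⟨ XorSum.sum-cong-≗ (λ w → trans (∧-identityʳ (S w)) (S-true w)) ⟩
        ⨁ {n} (λ _ → true)
          ≡⟨ ⨁-true n ⟩
        isOdd n
          ≡⟨ even ⟩
        false ∎))
    where
    open ≡-Reasoning
    inhabited : ∃[ w ] S w ∧ true ≡ true
    inhabited = ⨁-witness (λ w → S w ∧ true) odd
    S-true : ∀ w → S w ≡ true
    S-true w = trans (connected-constant conn S (λ e _ _ → closed e refl) tt tt)
                     (trans (sym (∧-identityʳ (S (proj₁ inhabited)))) (proj₂ inhabited))

≤1⊎≤1 : ∀ a b → a + b ≤ 3 → a ≤ 1 ⊎ b ≤ 1
≤1⊎≤1 0 b _ = inj₁ z≤n
≤1⊎≤1 1 b _ = inj₁ (s≤s z≤n)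
≤1⊎≤1 (suc (suc a)) b (s≤s (s≤s h)) = inj₂ (≤-trans (m≤n+m b a) h)

tricolour : Bool → Bool → ℕ
tricolour x y = if x then 0 else if y then 1 else 2

tricolour-0 : ∀ x y → ⌊ tricolour x y N.≟ 0 ⌋ ≡ x
tricolour-0 true y = refl
tricolour-0 false true = refl
tricolour-0 false false = refl

tricolour-1 : ∀ {x} y → x ≡ false → ⌊ tricolour x y N.≟ 1 ⌋ ≡ y
tricolour-1 true refl = refl
tricolour-1 false refl = refl

tricolour-01 : ∀ x y → (x ≡ false → y ≡ true) → tricolour x y ≡ 0 ⊎ tricolour x y ≡ 1
tricolour-01 true y _ = inj₁ refl
tricolour-01 false y h rewrite h refl = inj₂ refl

tricolour-02 : ∀ x y → (x ≡ false → y ≡ false) → tricolour x y ≡ 0 ⊎ tricolour x y ≡ 2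
tricolour-02 true y _ = inj₁ refl
tricolour-02 false y h rewrite h refl = inj₂ refl

tricolour-12 : ∀ {x} y → x ≡ false → tricolour x y ≡ 1 ⊎ tricolour x y ≡ 2
tricolour-12 true refl = inj₁ refl
tricolour-12 false refl = inj₂ refl

module Sides (G : Graph) where
  open Graph G

  record Side (u v : Fin n) (X : Fin n → Bool) : Set where
    field
      closed : ∀ g → src G g ≢ u → tgt G g ≢ u → src G g ≢ v → tgt G g ≢ v → X (src G g) ≡ X (tgt G g)
      avoids : ∀ w → X w ≡ true → w ≢ u × w ≢ v
      nonempty : ∃[ w ] X w ≡ true

  Split : Fin n → Fin n → Set
  Split u v = Σ (Fin n → Bool) λ X₀ → Σ (Fin n → Bool) λ X₁ →
    Side u v X₀ × Side u v X₁ × (∀ w → X₀ w ≡ true → X₁ w ≡ false)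

module OddOrder (G : Graph) (reg : FourRegular G) (odd : isOdd (Graph.n G) ≡ true) where
  open Graph G
  open Degrees G
  open Colourings G
  open Sides G

  otherEdgesAt : Fin n → Fin m → Fin m → Bool
  otherEdgesAt u e g = incident u g ∧ not (e == g)

  -- τ is chosen so that colour 1 (the edges p and a parity join of G - u - v) is odd away from u, v.
  module Attempt {u v e} (u≢v : u ≢ v) (e-joins : Joins e u v) (unique : ∀ g → Joins g u v → g ≡ e) where

    p : Fin m → Bool
    p = otherEdgesAt u e

    R : Fin n → Bool
    R w = not (u == w) ∧ not (v == w)

    A : Fin m → Bool
    A g = not (incident u g) ∧ not (incident v g)

    τ : Fin n → Bool
    τ w = R w ∧ not (isOdd (deg w p))

    open ParityJoins G A

    R-true : ∀ {w} → w ≢ u → w ≢ v → R w ≡ true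
    R-true w≢u w≢v rewrite ==-false (w≢u ∘ sym) | ==-false (w≢v ∘ sym) = refl

    R-avoids : ∀ {w} → R w ≡ true → w ≢ u × w ≢ v
    R-avoids h = (λ { refl → true≢false (trans (sym h) (cong (λ b → not b ∧ not (v == u)) (==-refl u))) }) ,
                 (λ { refl → true≢false (trans (sym h) (trans (cong (λ b → not (u == v) ∧ not b) (==-refl v))
                                                                     (∧-zeroʳ (not (u == v))))) })

    A-true : ∀ {g} → src G g ≢ u → tgt G g ≢ u → src G g ≢ v → tgt G g ≢ v → A g ≡ true
    A-true su tu sv tv rewrite nonincident su tu | nonincident sv tv = refl

    A-avoids : ∀ {g} → A g ≡ true → incident u g ≡ false × incident v g ≡ false
    A-avoids {g} h with incident u g | incident v g
    ... | false | false = refl , refl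

    deg-e-u : deg u (e ==_) ≡ 1
    deg-e-u = trans (deg-single u e) (endsAt-joins u≢v e-joins)

    deg-e-v : deg v (e ==_) ≡ 1
    deg-e-v = trans (deg-single v e) (endsAt-joins (u≢v ∘ sym) (joins-sym e-joins))

    deg-p-u : deg u p ≡ 3
    deg-p-u = suc-injective (begin
      1 + deg u p                 ≡⟨ cong (_+ deg u p) deg-e-u ⟨
      deg u (e ==_) + deg u p     ≡⟨ deg-split u (e ==_) p cover disjoint ⟨
      deg u (λ _ → true)          ≡⟨ reg u ⟩
      4                           ∎)
      where
      open ≡-Reasoning
      cover : ∀ g → incident u g ≡ true → true ≡ (e == g) ∨ p g
      cover g ug rewrite ug = sym (∨-inverseʳ (e == g))
      disjoint : ∀ g → (e == g) ∧ p g ≡ false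
      disjoint g with e == g
      ... | true = ∧-zeroʳ (incident u g)
      ... | false = refl

    p-avoids-v : ∀ g → incident v g ≡ true → p g ≡ false
    p-avoids-v g vg with incident u g in ug
    ... | false = refl
    ... | true rewrite unique g (incident-joins u≢v ug vg) = cong not (==-refl e)

    deg-p-v : deg v p ≡ 0
    deg-p-v = trans (deg-congᵢ v p-avoids-v) (deg-empty v)

    e-avoids : ∀ {w g} → w ≢ u → w ≢ v → incident w g ≡ true → e == g ≡ false
    e-avoids {w} {g} w≢u w≢v wg with e == g in eg
    ... | false = refl
    ... | true = ⊥-elim (true≢false (trans (sym wg) (subst (λ h → incident w h ≡ false) (==-sound eg) (e-at e-joins))))
      where
      e-at : Joins e u v → incident w e ≡ false
      e-at (inj₁ (su , tv)) = nonincident (λ h → w≢u (trans (sym h) su)) (λ h → w≢v (trans (sym h) tv))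
      e-at (inj₂ (sv , tu)) = nonincident (λ h → w≢v (trans (sym h) sv)) (λ h → w≢u (trans (sym h) tu))

    τ-even : ⨁ τ ≡ false
    τ-even = begin
      ⨁ τ
        ≡⟨ ⨁-without u≢v f ⟩
      (⨁ f xor f u) xor f v
        ≡⟨ cong₂ (λ x y → (x xor y) xor f v) ⨁f (cong (not ∘ isOdd) deg-p-u) ⟩
      (true xor false) xor f v
        ≡⟨ cong (λ y → (true xor false) xor not (isOdd y)) deg-p-v ⟩
      false ∎
      where
      open ≡-Reasoning
      f : Fin n → Bool
      f w = not (isOdd (deg w p))
      ⨁f : ⨁ f ≡ true
      ⨁f = trans (⨁-not (λ w → isOdd (deg w p))) (cong₂ _xor_ odd (handshake p))

    colourable : ParityJoin τ → Colourable31 G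
    colourable (F , F⊆A , parityF) = colourable31 {c} u local
      where
      c : Fin m → ℕ
      c g = tricolour (e == g) (p g ∨ F g)
      colour-0 : ∀ w → colourDeg G c w 0 ≡ deg w (e ==_)
      colour-0 w = deg-congᵢ w (λ g _ → tricolour-0 (e == g) (p g ∨ F g))
      at-u : ∀ g → incident u g ≡ true → e == g ≡ false → p g ∨ F g ≡ true
      at-u g ug eg rewrite ug | eg = refl
      at-v : ∀ g → incident v g ≡ true → p g ∨ F g ≡ false
      at-v g vg rewrite p-avoids-v g vg with F g in Fg
      ... | false = refl
      ... | true = ⊥-elim (true≢false (trans (sym vg) (proj₂ (A-avoids (F⊆A g Fg)))))
      p∧F : ∀ g → p g ∧ F g ≡ false
      p∧F g with F g in Fg
      ... | false = ∧-zeroʳ (p g)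
      ... | true rewrite proj₁ (A-avoids (F⊆A g Fg)) = refl
      odd-elsewhere : ∀ {w} → w ≢ u → w ≢ v → isOdd (colourDeg G c w 1) ≡ true
      odd-elsewhere {w} w≢u w≢v = begin
        isOdd (colourDeg G c w 1)
          ≡⟨ cong isOdd (deg-congᵢ w (λ g wg → tricolour-1 (p g ∨ F g) (e-avoids w≢u w≢v wg))) ⟩
        isOdd (deg w (λ g → p g ∨ F g))
          ≡⟨ cong isOdd (deg-split w p F (λ _ _ → refl) p∧F) ⟩
        isOdd (deg w p + deg w F)
          ≡⟨ isOdd-+ (deg w p) (deg w F) ⟩
        isOdd (deg w p) xor isOdd (deg w F)
          ≡⟨ cong (isOdd (deg w p) xor_) (trans (parityF w) (cong (_∧ not (isOdd (deg w p))) (R-true w≢u w≢v))) ⟩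
        isOdd (deg w p) xor not (isOdd (deg w p))
          ≡⟨ xor-inverseʳ (isOdd (deg w p)) ⟩
        true ∎
        where open ≡-Reasoning
      local : ∀ w → Local31 c w
      local w with w F.≟ u | w F.≟ v
      ... | yes refl | _ = local31 (reg w) (λ ()) (λ g ug → tricolour-01 (e == g) _ (at-u g ug))
                                   (cong isOdd (trans (colour-0 w) deg-e-u))
      ... | no _ | yes refl = local31 (reg w) (λ ()) (λ g vg → tricolour-02 (e == g) _ (λ _ → at-v g vg))
                                      (cong isOdd (trans (colour-0 w) deg-e-v))
      ... | no w≢u | no w≢v = local31 (reg w) (λ ()) (λ g wg → tricolour-12 (p g ∨ F g) (e-avoids w≢u w≢v wg))
                                      (odd-elsewhere w≢u w≢v)

    split : (Σ (Fin n → Bool) λ S →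
               (∀ g → A g ≡ true → S (src G g) ≡ S (tgt G g)) × ⨁ (λ w → S w ∧ τ w) ≡ true) →
            Split u v
    split (S , closed , oddS) = (λ w → S w ∧ R w) , (λ w → not (S w) ∧ R w) ,
      side S closed oddS ,
      side (not ∘ S) (λ g Ag → cong not (closed g Ag)) oddNotS ,
      λ w h → cong (λ x → not x ∧ R w) (proj₁ (∧-true {S w} h))
      where
      side : (S′ : Fin n → Bool) → (∀ g → A g ≡ true → S′ (src G g) ≡ S′ (tgt G g)) →
             ⨁ (λ w → S′ w ∧ τ w) ≡ true → Side u v (λ w → S′ w ∧ R w)
      side S′ closed′ odd′ = record
        { closed = λ g su tu sv tv →
            cong₂ _∧_ (closed′ g (A-true su tu sv tv)) (trans (R-true su sv) (sym (R-true tu tv)))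
        ; avoids = λ w h → R-avoids (proj₂ (∧-true {S′ w} h))
        ; nonempty = let (w , h) = ⨁-witness _ odd′
                         (S′w , τw) = ∧-true {S′ w} h
                     in w , cong₂ _∧_ S′w (proj₁ (∧-true {R w} τw))
        }
      oddNotS : ⨁ (λ w → not (S w) ∧ τ w) ≡ true
      oddNotS = begin
        ⨁ (λ w → not (S w) ∧ τ w)           ≡⟨ XorSum.sum-cong-≗ (λ w → not-∧ (S w) (τ w)) ⟩
        ⨁ (λ w → τ w xor (S w ∧ τ w))       ≡⟨ XorSum.∑-distrib-+ τ (λ w → S w ∧ τ w) ⟩
        ⨁ τ xor ⨁ (λ w → S w ∧ τ w)         ≡⟨ cong₂ _xor_ τ-even oddS ⟩
        true                                ∎
        where
        open ≡-Reasoning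
        not-∧ : ∀ a t → not a ∧ t ≡ t xor (a ∧ t)
        not-∧ false t = sym (xor-identityʳ t)
        not-∧ true t = sym (xor-same t)

    colourable⊎split : Colourable31 G ⊎ Split u v
    colourable⊎split with parityJoin⊎obstruction τ
    ... | inj₁ J = inj₁ (colourable J)
    ... | inj₂ O = inj₂ (split O)

  touches : (Fin n → Bool) → Fin m → Bool
  touches X g = X (src G g) ∨ X (tgt G g)

  far : Fin n → Fin m → Fin n
  far u g = if src G g == u then tgt G g else src G g

  touches-far : ∀ {u g} X → incident u g ≡ true → X u ≡ false → touches X g ≡ X (far u g)
  touches-far {u} {g} X ug Xu with src G g == u in su
  ... | true rewrite ==-sound su | Xu = refl
  ... | false rewrite ==-sound ug | Xu = ∨-identityʳ _

  joins-far : ∀ {u g} → incident u g ≡ true → Joins g u (far u g)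
  joins-far {u} {g} ug with src G g == u in su
  ... | true = inj₁ (==-sound su , refl)
  ... | false = inj₂ (refl , ==-sound ug)

  touches-at : ∀ {X y g} → incident y g ≡ true → X y ≡ true → touches X g ≡ true
  touches-at {X} {g = g} yg Xy with incident-ends yg
  ... | inj₁ refl rewrite Xy = refl
  ... | inj₂ refl rewrite Xy = ∨-zeroʳ (X (src G g))

  module _ {u v X} (side : Side u v X) where
    open Side side

    side-u : X u ≡ false
    side-u = ¬-not (λ Xu → proj₁ (avoids u Xu) refl)

    side-v : X v ≡ false
    side-v = ¬-not (λ Xv → proj₂ (avoids v Xv) refl)

    touching-other : ∀ {e g} → Joins e u v → incident u g ≡ true → touches X g ≡ true → otherEdgesAt u e g ≡ true
    touching-other {e} {g} e-joins ug Xg with e == g in eg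
    ... | false rewrite ug = refl
    ... | true rewrite sym (==-sound eg) = ⊥-elim (true≢false (trans (sym Xg) (untouched e-joins)))
      where
      untouched : Joins e u v → touches X e ≡ false
      untouched (inj₁ (refl , refl)) rewrite side-u | side-v = refl
      untouched (inj₂ (refl , refl)) rewrite side-u | side-v = refl

  module _ (conn : ∀ z → ConnectedOn G (λ y → y ≢ z)) (ncol : ¬ Colourable31 G) where

    split : ∀ {u v e} → u ≢ v → Joins e u v → (∀ g → Joins g u v → g ≡ e) → Split u v
    split u≢v e-joins unique with Attempt.colourable⊎split u≢v e-joins unique
    ... | inj₁ col = ⊥-elim (ncol col)
    ... | inj₂ s = s

    entered : ∀ {u v X} → u ≢ v → Side u v X → ∃[ g ] incident u g ≡ true × touches X g ≡ true
    entered {u} {v} {X} u≢v side with any? (λ g → incident u g ∧ touches X g Bool.≟ true)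
    ... | yes (g , h) = g , ∧-true h
    ... | no none = ⊥-elim (true≢false (trans (sym Xw) (trans (connected-constant (conn v) X closed w≢v u≢v) (side-u side))))
      where
      open Side side using (avoids; nonempty)
      w = proj₁ nonempty
      Xw = proj₂ nonempty
      w≢v = proj₂ (avoids w Xw)
      closed : ∀ g → src G g ≢ v → tgt G g ≢ v → X (src G g) ≡ X (tgt G g)
      closed g sv tv with incident u g in ug
      ... | true = let (s , t) = ∨-false (¬-not (λ Xg → none (g , cong₂ _∧_ ug Xg))) in trans s (sym t)
      ... | false = Side.closed side g (proj₁ (nonincident⁻¹ ug)) (proj₂ (nonincident⁻¹ ug)) sv tv

    module _ {u v e} (u≢v : u ≢ v) (e-joins : Joins e u v) (unique : ∀ g → Joins g u v → g ≡ e) where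

      record SoleEntry : Set where
        field
          X : Fin n → Bool
          side : Side u v X
          f : Fin m
          f-at-u : incident u f ≡ true
          f-touches : touches X f ≡ true
          f-unique : ∀ g → incident u g ≡ true → touches X g ≡ true → g ≡ f

      private
        p : Fin m → Bool
        p = otherEdgesAt u e

        entering : (Fin n → Bool) → Fin m → Bool
        entering X g = p g ∧ touches X g

        soleEntry-from : ∀ {X} → Side u v X → deg u (entering X) ≤ 1 → SoleEntry
        soleEntry-from {X} side few with entered u≢v side
        ... | f , uf , Xf = record
          { X = X ; side = side ; f = f ; f-at-u = uf ; f-touches = Xf
          ; f-unique = λ g ug Xg → sym (deg≤1⇒unique u few (enters f uf Xf) (enters g ug Xg) uf ug) }
          where
          enters : ∀ g → incident u g ≡ true → touches X g ≡ true → entering X g ≡ true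
          enters g ug Xg = cong₂ _∧_ (touching-other side e-joins ug Xg) Xg

      soleEntry : SoleEntry
      soleEntry with split u≢v e-joins unique
      ... | X₀ , X₁ , side₀ , side₁ , X₀⇒¬X₁ with ≤1⊎≤1 _ _ bound
        where
        disjoint : ∀ g → entering X₀ g ∧ entering X₁ g ≡ false
        disjoint g with p g in pg
        ... | false = refl
        ... | true rewrite touches-far X₀ (proj₁ (∧-true pg)) (side-u side₀)
                         | touches-far X₁ (proj₁ (∧-true pg)) (side-u side₁) with X₀ (far u g) in X₀g
        ...   | true = X₀⇒¬X₁ _ X₀g
        ...   | false = refl
        bound : deg u (entering X₀) + deg u (entering X₁) ≤ 3
        bound = subst (deg u (entering X₀) + deg u (entering X₁) ≤_) (Attempt.deg-p-u u≢v e-joins unique)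
          (deg-disjoint-≤ u (entering X₀) (entering X₁) disjoint
                          (λ g h → proj₁ (∧-true {p g} h)) (λ g h → proj₁ (∧-true {p g} h)))
      ... | inj₁ few = soleEntry-from side₀ few
      ... | inj₂ few = soleEntry-from side₁ few

      module _ (entry : SoleEntry) where
        open SoleEntry entry

        private
          x : Fin n
          x = far u f

          Xx : X x ≡ true
          Xx = trans (sym (touches-far X f-at-u (side-u side))) f-touches

          x≢v : x ≢ v
          x≢v = proj₂ (Side.avoids side x Xx)

          u≢x : u ≢ x
          u≢x u≡x = proj₁ (Side.avoids side x Xx) (sym u≡x)

          f-unique′ : ∀ g → Joins g u x → g ≡ f
          f-unique′ g g-joins =
            f-unique g (proj₁ (joins-incident g-joins)) (touches-at {X} (proj₂ (joins-incident g-joins)) Xx)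

          -- T leaves X: then u separates T - X from v.
          escape : ∀ {T} → Side u x T → T v ≡ false → ∃[ w ] T w ∧ not (X w) ≡ true → ⊥
          escape {T} sideT Tv (w , Yw) =
            true≢false (trans (sym Yw) (trans (connected-constant (conn u) Y closedY w≢u (u≢v ∘ sym)) Yv))
            where
            Y : Fin n → Bool
            Y w = T w ∧ not (X w)
            w≢u = proj₁ (Side.avoids sideT w (proj₁ (∧-true {T w} Yw)))
            Yv : Y v ≡ false
            Yv = cong (_∧ not (X v)) Tv
            step : ∀ {a b} → (a ≢ x → b ≢ x → T a ≡ T b) → (a ≢ v → b ≢ v → X a ≡ X b) →
                   Y a ≡ true → Y b ≡ true
            step {a} {b} closedT closedX Ya = cong₂ (λ s t → s ∧ not t) Tb Xb
              where
              Ta : T a ≡ true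
              Ta = proj₁ (∧-true {T a} Ya)
              Xa : X a ≡ false
              Xa = not-true (proj₂ (∧-true {T a} Ya))
              a≢v : a ≢ v
              a≢v a≡v = true≢false (trans (sym Ta) (trans (cong T a≡v) Tv))
              b≢x : b ≢ x
              b≢x b≡x = true≢false (trans (sym Xa≡true) Xa)
                where
                Xa≡true : X a ≡ true
                Xa≡true = trans (closedX a≢v (λ b≡v → x≢v (trans (sym b≡x) b≡v))) (trans (cong X b≡x) Xx)
              Tb : T b ≡ true
              Tb = trans (sym (closedT (proj₂ (Side.avoids sideT a Ta)) b≢x)) Ta
              Xb : X b ≡ false
              Xb = trans (sym (closedX a≢v (λ b≡v → true≢false (trans (sym Tb) (trans (cong T b≡v) Tv))))) Xa
            closedY : ∀ g → src G g ≢ u → tgt G g ≢ u → Y (src G g) ≡ Y (tgt G g)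
            closedY g su tu = Bool-≡
              (step (Side.closed sideT g su tu) (Side.closed side g su tu))
              (step (λ a b → sym (Side.closed sideT g su tu b a)) (λ a b → sym (Side.closed side g su tu b a)))

          -- T lies in X: f is the only edge from u into X, so x separates T from v.
          inside : ∀ {T} → Side u x T → T v ≡ false → (∀ w → T w ≡ true → X w ≡ true) → ⊥
          inside {T} sideT Tv T⊆X =
            true≢false (trans (sym Tw) (trans (connected-constant (conn x) T closedT w≢x (x≢v ∘ sym)) Tv))
            where
            open Side sideT using (avoids; nonempty)
            w : Fin n
            w = proj₁ nonempty
            Tw : T w ≡ true
            Tw = proj₂ nonempty
            w≢x : w ≢ x
            w≢x = proj₂ (avoids w Tw)
            not-end : ∀ {y} → T y ≡ true → ¬ (y ≡ u ⊎ y ≡ x)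
            not-end Ty (inj₁ y≡u) = proj₁ (avoids _ Ty) y≡u
            not-end Ty (inj₂ y≡x) = proj₂ (avoids _ Ty) y≡x
            on-f : ∀ {g y} → incident u g ≡ true → incident y g ≡ true → T y ≡ true → incident y f ≡ true
            on-f {g} {y} ug yg Ty =
              subst (λ h → incident y h ≡ true) (f-unique g ug (touches-at {X} yg (T⊆X y Ty))) yg
            off : ∀ {g y} → incident u g ≡ true → incident y g ≡ true → T y ≡ false
            off ug yg = ¬-not (λ Ty → not-end Ty (joins-ends (joins-far f-at-u) (on-f ug yg Ty)))
            closedT : ∀ g → src G g ≢ x → tgt G g ≢ x → T (src G g) ≡ T (tgt G g)
            closedT g sx tx with incident u g in ug
            ... | true = trans (off ug (incident-src g)) (sym (off ug (incident-tgt g)))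
            ... | false = Side.closed sideT g (proj₁ (nonincident⁻¹ ug)) (proj₂ (nonincident⁻¹ ug)) sx tx

          trapped : ∀ {T} → Side u x T → T v ≡ false → ⊥
          trapped {T} sideT Tv with any? (λ w → T w ∧ not (X w) Bool.≟ true)
          ... | yes esc = escape sideT Tv esc
          ... | no ¬esc = inside sideT Tv T⊆X
            where
            T⊆X : ∀ w → T w ≡ true → X w ≡ true
            T⊆X w Tw with X w in Xw
            ... | true = refl
            ... | false = ⊥-elim (¬esc (w , cong₂ (λ s t → s ∧ not t) Tw Xw))

        soleEntry-absurd : ⊥
        soleEntry-absurd with split u≢x (joins-far f-at-u) f-unique′
        ... | T₀ , T₁ , side₀ , side₁ , T₀⇒¬T₁ with T₀ v in T₀v
        ...   | false = trapped side₀ T₀v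
        ...   | true = trapped side₁ (T₀⇒¬T₁ v T₀v)

    nonDoubleEdge-absurd : ∀ {e} → NonDoubleNonLoop G e → ⊥
    nonDoubleEdge-absurd {e} (u≢v , unique) = soleEntry-absurd u≢v e-joins unique (soleEntry u≢v e-joins unique)
      where
      e-joins : Joins e (src G e) (tgt G e)
      e-joins = inj₁ (refl , refl)

lemma5 : (G : Graph) → FourRegular G → ¬ Colourable31 G →
         ∃[ e ] NonDoubleNonLoop G e → ¬ TwoConnected G
lemma5 G reg ncol (e₀ , ndl) (3≤n , conn , conn-minus) = byParity (isOdd (Graph.n G)) refl
  where
  byParity : ∀ b → isOdd (Graph.n G) ≡ b → ⊥
  byParity false even =
    ncol (Colourings.evenOrder-colourable G reg conn even (F.fromℕ< (≤-trans (s≤s z≤n) 3≤n)))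
  byParity true odd = OddOrder.nonDoubleEdge-absurd G reg odd conn-minus ncol ndl
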